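{- Let $G$ be a nontrivial finite group, let $I,J\in\mathcal{I}$ with $X_I\neq X_J$, and let $P\in X_I$. Then some option of $P$ in $\mathsf{DNG}(G)$ lies in $X_J$ if and only if some option of $I$ in $\mathsf{DNG}(G)$ lies in $X_J$.
   Context: The avoidance game $\mathsf{DNG}(G)$ has as positions the subsets $P\subseteq G$ with $\langle P\rangle\neq G$, and the options of $P$ are $\operatorname{Opt}(P)=\{P\cup\{g\}:g\in G\setminus P,\ \langle P\cup\{g\}\rangle\neq G\}$. Let $\mathcal{M}$ be the set of maximal subgroups of $G$ and $\mathcal{I}=\{\bigcap\mathcal{N}:\emptyset\neq\mathcal{N}\subseteq\mathcal{M}\}$. For $I\in\mathcal{I}$, $X_I=\{P\subseteq I: \text{there is no } J\in\mathcal{I} \text{ with } J\subsetneq I \text{ and } P\subseteq J\}$. -}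

module Defs where

open import Level using (0ℓ)
open import Data.Nat using (ℕ)
open import Data.Fin using (Fin)
open import Data.Fin.Subset using (Subset; _∈_; _∉_; _⊆_; _∩_; _∪_; ⁅_⁆; ⊤)
open import Data.List using (List; []; _∷_; foldr)
open import Data.List.Relation.Unary.All using (All)
open import Data.Product using (Σ; _×_; ∃)
open import Data.Sum using (_⊎_)
open import Relation.Binary.PropositionalEquality using (_≡_; _≢_)
open import Relation.Nullary using (¬_)
open import Algebra.Core using (Op₁; Op₂)
open import Algebra.Structures using (IsGroup)

-- A finite group, presented (up to isomorphism) on the carrier Fin n,
-- with propositional equality as the group equality.
record FinGroup : Set where
  field
    n       : ℕ
    _∙_     : Op₂ (Fin n)
    ε       : Fin n
    _⁻¹     : Op₁ (Fin n)
    isGroup : IsGroup _≡_ _∙_ ε _⁻¹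

module _ (G : FinGroup) where
  open FinGroup G

  Nontrivial : Set
  Nontrivial = Σ (Fin n) λ g → g ≢ ε

  IsSubgroup : Subset n → Set
  IsSubgroup H = (ε ∈ H)
               × (∀ {x y} → x ∈ H → y ∈ H → (x ∙ y) ∈ H)
               × (∀ {x} → x ∈ H → (x ⁻¹) ∈ H)

  _∈⟨_⟩ : Fin n → Subset n → Set
  g ∈⟨ P ⟩ = ∀ H → IsSubgroup H → P ⊆ H → g ∈ H

  Generates : Subset n → Set
  Generates P = ∀ g → g ∈⟨ P ⟩

  IsMaximal : Subset n → Set
  IsMaximal M = IsSubgroup M × M ≢ ⊤
              × (∀ H → IsSubgroup H → M ⊆ H → (H ≡ M) ⊎ (H ≡ ⊤))

  -- intersection of a nonempty family (given as head ∷ tail)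
  ⋂ : Subset n → List (Subset n) → Subset n
  ⋂ M Ms = foldr _∩_ M Ms

  In𝓘 : Subset n → Set
  In𝓘 I = Σ (Subset n) λ M → Σ (List (Subset n)) λ Ms →
            IsMaximal M × All IsMaximal Ms × I ≡ ⋂ M Ms

  X : Subset n → Subset n → Set
  X I P = P ⊆ I × ¬ (Σ (Subset n) λ J → In𝓘 J × J ⊆ I × J ≢ I × P ⊆ J)

  Opt : Subset n → Subset n → Set
  Opt P Q = Σ (Fin n) λ g → g ∉ P × Q ≡ P ∪ ⁅ g ⁆ × ¬ Generates (P ∪ ⁅ g ⁆)

module Submission where

-- Every member of 𝓘 lies in a maximal subgroup, so no subset of it generates
-- G, and 𝓘 is closed under intersection.  Hence P ∈ X_I says exactly that I
-- is the least member of 𝓘 containing P.  Then P ∪ {g} and I ∪ {g} lie below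
-- the same members of 𝓘, so they belong to the same sets X_J, and options of
-- P correspond to options of I.  The one subtle point is that g ∉ P with
-- P ∪ {g} ∈ X_J forces g ∉ I: otherwise I would be least above both P and
-- P ∪ {g}, giving I = J and hence X_I = X_J.

open import Defs
open import Data.Fin using (Fin)
open import Data.Fin.Subset using (Subset; _∈_; _∉_; _⊆_; _∩_; _∪_; ⁅_⁆; ⊤)
open import Data.Fin.Subset.Properties
  using (⊆-antisym; _⊆?_; ⊆⊤; p∩q⊆p; p∩q⊆q; x∈p∩q⁺; x∈p∩q⁻;
         p⊆p∪q; q⊆p∪q; x∈p∪q⁻; x∈⁅y⁆⇒x≡y)
open import Data.List using ([]; _∷_; _++_)
open import Data.List.Relation.Unary.All using (All; []; _∷_)
open import Data.List.Relation.Unary.All.Properties using (++⁺; ++⁻)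
open import Data.Product using (Σ; _×_; _,_; proj₁)
open import Data.Sum using ([_,_])
open import Function using (_∘_; id)
open import Function.Bundles using (_⇔_; mk⇔; Equivalence)
open import Function.Construct.Symmetry using (⇔-sym)
open import Data.Empty using (⊥-elim)
open import Relation.Nullary using (¬_; yes; no)
open import Relation.Binary.PropositionalEquality
  using (_≡_; _≢_; refl; sym; subst)

∪-least : ∀ {n} {p q r : Subset n} → p ⊆ r → q ⊆ r → p ∪ q ⊆ r
∪-least p⊆r q⊆r = [ p⊆r , q⊆r ] ∘ x∈p∪q⁻ _ _

∩-greatest : ∀ {n} {p q r : Subset n} → r ⊆ p → r ⊆ q → r ⊆ p ∩ q
∩-greatest r⊆p r⊆q x∈r = x∈p∩q⁺ (r⊆p x∈r , r⊆q x∈r)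

⁅⁆⊆ : ∀ {n} {x : Fin n} {p : Subset n} → x ∈ p → ⁅ x ⁆ ⊆ p
⁅⁆⊆ {p = p} x∈p y∈⁅x⁆ = subst (_∈ p) (sym (x∈⁅y⁆⇒x≡y _ y∈⁅x⁆)) x∈p

module _ (G : FinGroup) where
  open FinGroup G using (n)

  ∈-⋂⁺ : ∀ {x M Ms} → x ∈ M → All (x ∈_) Ms → x ∈ ⋂ G M Ms
  ∈-⋂⁺ x∈M []           = x∈M
  ∈-⋂⁺ x∈M (x∈M′ ∷ x∈Ms) = x∈p∩q⁺ (x∈M′ , ∈-⋂⁺ x∈M x∈Ms)

  ∈-⋂⁻ : ∀ {x M} Ms → x ∈ ⋂ G M Ms → x ∈ M × All (x ∈_) Ms
  ∈-⋂⁻ []        x∈M = x∈M , []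
  ∈-⋂⁻ (M′ ∷ Ms) x∈⋂ with x∈p∩q⁻ M′ _ x∈⋂
  ... | x∈M′ , x∈⋂Ms with ∈-⋂⁻ Ms x∈⋂Ms
  ...   | x∈M , x∈Ms = x∈M , x∈M′ ∷ x∈Ms

  ⋂-⊆-head : ∀ {M} Ms → ⋂ G M Ms ⊆ M
  ⋂-⊆-head Ms = proj₁ ∘ ∈-⋂⁻ Ms

  ⋂-++-∷ : ∀ M Ms M′ Ms′ → ⋂ G M (Ms ++ M′ ∷ Ms′) ≡ ⋂ G M Ms ∩ ⋂ G M′ Ms′
  ⋂-++-∷ M Ms M′ Ms′ = ⊆-antisym split join
    where
    split : ⋂ G M (Ms ++ M′ ∷ Ms′) ⊆ ⋂ G M Ms ∩ ⋂ G M′ Ms′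
    split x∈⋂ with ∈-⋂⁻ (Ms ++ M′ ∷ Ms′) x∈⋂
    ... | x∈M , x∈Ms++ with ++⁻ Ms x∈Ms++
    ...   | x∈Ms , x∈M′ ∷ x∈Ms′ = x∈p∩q⁺ (∈-⋂⁺ x∈M x∈Ms , ∈-⋂⁺ x∈M′ x∈Ms′)

    join : ⋂ G M Ms ∩ ⋂ G M′ Ms′ ⊆ ⋂ G M (Ms ++ M′ ∷ Ms′)
    join x∈∩ with x∈p∩q⁻ (⋂ G M Ms) _ x∈∩
    ... | x∈⋂ , x∈⋂′ with ∈-⋂⁻ Ms x∈⋂ | ∈-⋂⁻ Ms′ x∈⋂′
    ...   | x∈M , x∈Ms | x∈M′ , x∈Ms′ = ∈-⋂⁺ x∈M (++⁺ x∈Ms (x∈M′ ∷ x∈Ms′))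

  In𝓘-∩ : ∀ {I K} → In𝓘 G I → In𝓘 G K → In𝓘 G (I ∩ K)
  In𝓘-∩ (M , Ms , maxM , maxMs , refl) (M′ , Ms′ , maxM′ , maxMs′ , refl) =
    M , Ms ++ M′ ∷ Ms′ , maxM , ++⁺ maxMs (maxM′ ∷ maxMs′) , sym (⋂-++-∷ M Ms M′ Ms′)

  proper-subgroup⇒¬Generates : ∀ {H Q} → IsSubgroup G H → H ≢ ⊤ → Q ⊆ H →
                               ¬ Generates G Q
  proper-subgroup⇒¬Generates subH H≢⊤ Q⊆H gen =
    H≢⊤ (⊆-antisym ⊆⊤ λ {g} _ → gen g _ subH Q⊆H)

  X⇒¬Generates : ∀ {J Q} → In𝓘 G J → X G J Q → ¬ Generates G Q
  X⇒¬Generates (M , Ms , (subM , M≢⊤ , _) , _ , refl) (Q⊆J , _) =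
    proper-subgroup⇒¬Generates subM M≢⊤ (⋂-⊆-head Ms ∘ Q⊆J)

  X-least : ∀ {I P K} → In𝓘 G I → X G I P → In𝓘 G K → P ⊆ K → I ⊆ K
  X-least {I} {P} {K} 𝓘I (P⊆I , noSmaller) 𝓘K P⊆K with I ⊆? K
  ... | yes I⊆K = I⊆K
  ... | no  I⊈K =
    ⊥-elim (noSmaller (I ∩ K , In𝓘-∩ 𝓘I 𝓘K , I∩K⊆I , I⊈K ∘ I∩K≡I⇒I⊆K , P⊆I∩K))
    where
    I∩K⊆I : I ∩ K ⊆ I
    I∩K⊆I = p∩q⊆p I K

    P⊆I∩K : P ⊆ I ∩ K
    P⊆I∩K = ∩-greatest P⊆I P⊆K

    I∩K≡I⇒I⊆K : I ∩ K ≡ I → I ⊆ K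
    I∩K≡I⇒I⊆K eq = subst (_⊆ K) eq (p∩q⊆q I K)

  X-sandwich : ∀ {I J P Q} → In𝓘 G I → In𝓘 G J → X G I P → X G J Q →
               P ⊆ Q → Q ⊆ I → I ≡ J
  X-sandwich 𝓘I 𝓘J XIP XJQ P⊆Q Q⊆I =
    ⊆-antisym (X-least 𝓘I XIP 𝓘J (proj₁ XJQ ∘ P⊆Q)) (X-least 𝓘J XJQ 𝓘I Q⊆I)

  Same𝓘Bounds : Subset n → Subset n → Set
  Same𝓘Bounds Q Q′ = ∀ K → In𝓘 G K → Q ⊆ K ⇔ Q′ ⊆ K

  Same𝓘Bounds-sym : ∀ {Q Q′} → Same𝓘Bounds Q Q′ → Same𝓘Bounds Q′ Q
  Same𝓘Bounds-sym same K 𝓘K = ⇔-sym (same K 𝓘K)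

  X-resp-Same𝓘Bounds : ∀ {J Q Q′} → In𝓘 G J → Same𝓘Bounds Q Q′ → X G J Q → X G J Q′
  X-resp-Same𝓘Bounds 𝓘J same (Q⊆J , noSmaller) =
    Equivalence.to (same _ 𝓘J) Q⊆J ,
    λ (K , 𝓘K , K⊆J , K≢J , Q′⊆K) →
      noSmaller (K , 𝓘K , K⊆J , K≢J , Equivalence.from (same K 𝓘K) Q′⊆K)

  X⇒Same𝓘Bounds-∪ : ∀ {I P} → In𝓘 G I → X G I P → ∀ R → Same𝓘Bounds (P ∪ R) (I ∪ R)
  X⇒Same𝓘Bounds-∪ {I} {P} 𝓘I XIP R K 𝓘K = mk⇔ enlarge shrink
    where
    enlarge : P ∪ R ⊆ K → I ∪ R ⊆ K
    enlarge P∪R⊆K = ∪-least (X-least 𝓘I XIP 𝓘K (P∪R⊆K ∘ p⊆p∪q R))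
                            (P∪R⊆K ∘ q⊆p∪q P R)

    shrink : I ∪ R ⊆ K → P ∪ R ⊆ K
    shrink I∪R⊆K = I∪R⊆K ∘ ∪-least (p⊆p∪q R ∘ proj₁ XIP) (q⊆p∪q I R)

proposition3p10 : (G : FinGroup) → Nontrivial G →
    (I J : Subset (FinGroup.n G)) → In𝓘 G I → In𝓘 G J →
    ¬ (∀ Q → X G I Q ⇔ X G J Q) →
    (P : Subset (FinGroup.n G)) → X G I P →
    ((Σ (Subset (FinGroup.n G)) λ Q → Opt G P Q × X G J Q)
      ⇔ (Σ (Subset (FinGroup.n G)) λ Q → Opt G I Q × X G J Q))
proposition3p10 G _ I J 𝓘I 𝓘J X≢ P XIP = mk⇔ fwd bwd
  where
  bounds : ∀ g → Same𝓘Bounds G (P ∪ ⁅ g ⁆) (I ∪ ⁅ g ⁆)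
  bounds g = X⇒Same𝓘Bounds-∪ G 𝓘I XIP ⁅ g ⁆

  fwd : Σ _ (λ Q → Opt G P Q × X G J Q) → Σ _ (λ Q → Opt G I Q × X G J Q)
  fwd (_ , (g , _ , refl , _) , XJPg) =
    I ∪ ⁅ g ⁆ , (g , g∉I , refl , X⇒¬Generates G 𝓘J XJIg) , XJIg
    where
    XJIg = X-resp-Same𝓘Bounds G 𝓘J (bounds g) XJPg

    g∉I : g ∉ I
    g∉I g∈I = X≢ λ Q → subst (λ K → X G I Q ⇔ X G K Q) I≡J (mk⇔ id id)
      where
      I≡J = X-sandwich G 𝓘I 𝓘J XIP XJPg (p⊆p∪q ⁅ g ⁆) (∪-least (proj₁ XIP) (⁅⁆⊆ g∈I))

  bwd : Σ _ (λ Q → Opt G I Q × X G J Q) → Σ _ (λ Q → Opt G P Q × X G J Q)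
  bwd (_ , (g , g∉I , refl , _) , XJIg) =
    P ∪ ⁅ g ⁆ , (g , g∉I ∘ proj₁ XIP , refl , X⇒¬Generates G 𝓘J XJPg) , XJPg
    where
    XJPg = X-resp-Same𝓘Bounds G 𝓘J (Same𝓘Bounds-sym G (bounds g)) XJIg
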